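{- Let $A$ be a nonrecursive c.e. set. Suppose $\overline A=K\sqcup T$ (disjoint union), where $K\subseteq\overline A$ is c.e., and such that for every set $B\equiv_{\rm m}A$: (1) for every many-one reduction $h\colon A\le_{\rm m}B$, the set $D_h\cap T$ is finite; and (2) for every many-one reduction $f\colon B\le_{\rm m}A$, the set $f^{ -1}(K)$ is infinite. Then $A$ represents the least finite-one degree inside its many-one degree, i.e. $A\le_{\rm fo}B$ for every $B\equiv_{\rm m}A$.
   Context: All sets are subsets of $\omega$; $\overline X=\omega\setminus X$. $A\le_{\rm m}B$ via total computable $h$ means $x\in A\iff h(x)\in B$ for all $x$; $\equiv_{\rm m}$ is mutual $\le_{\rm m}$. $A\le_{\rm fo}B$: there is total computable $g$ with $x\in A\iff g(x)\in B$ and every fibre $g^{ -1}(\{y\})$ finite. For $h\colon A\le_{\rm m}B$, $D_h:=\{x\in\overline A:(\exists y<x)[\,y\in\overline A\text{ and }h(y)=h(x)\,]\}$. -}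

module Defs where

open import Data.Nat using (ℕ; zero; suc; _<_)
open import Data.Fin using (Fin)
open import Data.Vec using (Vec; []; _∷_; lookup)
open import Data.Product using (Σ; ∃; _×_; _,_)
open import Data.Sum using (_⊎_)
open import Relation.Nullary using (¬_)
open import Relation.Binary.PropositionalEquality using (_≡_)

Subset : Set₁
Subset = ℕ → Set

co : Subset → Subset
co A x = ¬ A x

_⇔'_ : Set → Set → Set
P ⇔' Q = (P → Q) × (Q → P)

data PR : ℕ → Set where
  Z    : ∀ {n} → PR n
  S    : PR 1
  P    : ∀ {n} → Fin n → PR n
  comp : ∀ {m n} → PR m → Vec (PR n) m → PR n
  prec : ∀ {n} → PR n → PR (suc (suc n)) → PR (suc n)
  mu   : ∀ {n} → PR (suc n) → PR n

mutual
  data Eval : ∀ {n} → PR n → Vec ℕ n → ℕ → Set where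
    eZ    : ∀ {n} {xs : Vec ℕ n} → Eval Z xs 0
    eS    : ∀ {x} → Eval S (x ∷ []) (suc x)
    eP    : ∀ {n} (i : Fin n) {xs : Vec ℕ n} → Eval (P i) xs (lookup xs i)
    ecomp : ∀ {m n} {f : PR m} {gs : Vec (PR n) m} {xs : Vec ℕ n}
              {ys : Vec ℕ m} {r : ℕ} →
            EvalAll gs xs ys → Eval f ys r → Eval (comp f gs) xs r
    eprecZ : ∀ {n} {g : PR n} {s : PR (suc (suc n))} {xs : Vec ℕ n} {r : ℕ} →
             Eval g xs r → Eval (prec g s) (0 ∷ xs) r
    eprecS : ∀ {n} {g : PR n} {s : PR (suc (suc n))} {xs : Vec ℕ n}
               {y r r' : ℕ} →
             Eval (prec g s) (y ∷ xs) r → Eval s (y ∷ r ∷ xs) r' →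
             Eval (prec g s) (suc y ∷ xs) r'
    emu   : ∀ {n} {f : PR (suc n)} {xs : Vec ℕ n} {y : ℕ} →
            Eval f (y ∷ xs) 0 →
            (∀ z → z < y → Σ ℕ λ k → Eval f (z ∷ xs) (suc k)) →
            Eval (mu f) xs y

  data EvalAll : ∀ {m n} → Vec (PR n) m → Vec ℕ n → Vec ℕ m → Set where
    [] : ∀ {n} {xs : Vec ℕ n} → EvalAll [] xs []
    _∷_ : ∀ {m n} {g : PR n} {gs : Vec (PR n) m} {xs : Vec ℕ n}
            {y : ℕ} {ys : Vec ℕ m} →
          Eval g xs y → EvalAll gs xs ys → EvalAll (g ∷ gs) xs (y ∷ ys)

Computable : (ℕ → ℕ) → Set
Computable f = Σ (PR 1) λ e → ∀ x → Eval e (x ∷ []) (f x)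

CE : Subset → Set
CE A = Σ (PR 1) λ e → ∀ x → A x ⇔' (Σ ℕ λ y → Eval e (x ∷ []) y)

-- recursive = has a computable characteristic function (0 = member).
Recursive : Subset → Set
Recursive A = Σ (ℕ → ℕ) λ χ → Computable χ × (∀ x → A x ⇔' (χ x ≡ 0))

Finite : Subset → Set
Finite X = Σ ℕ λ n → ∀ x → X x → x < n

Infinite : Subset → Set
Infinite X = ¬ Finite X

_∩_ : Subset → Subset → Subset
(X ∩ Y) x = X x × Y x

IsMReduction : Subset → Subset → (ℕ → ℕ) → Set
IsMReduction A B h = ∀ x → A x ⇔' B (h x)

_≤m_ : Subset → Subset → Set
A ≤m B = Σ (ℕ → ℕ) λ h → Computable h × IsMReduction A B h

_≡m_ : Subset → Subset → Set
A ≡m B = (A ≤m B) × (B ≤m A)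

FiniteOne : (ℕ → ℕ) → Set
FiniteOne g = ∀ y → Finite (λ x → g x ≡ y)

_≤fo_ : Subset → Subset → Set
A ≤fo B = Σ (ℕ → ℕ) λ g → Computable g × IsMReduction A B g × FiniteOne g

D : Subset → (ℕ → ℕ) → Subset
D A h x = co A x × (Σ ℕ λ y → y < x × co A y × h y ≡ h x)

-- Fix h : A ≤m B and f : B ≤m A, and let n₀ bound D_h ∩ T. Call x a late repeat if x ≥ n₀ and
-- h x = h x′ for some x′ < x. The reduction g keeps g x = h x except at late repeats. A late
-- repeat outside A lies in D_h ∩ T unless it lies in K, so by the choice of n₀ every late repeat
-- is enumerated into A or into K, and waiting for that decides membership in A. Accordingly g
-- sends a late repeat x to some y ≥ x in B, or to some y ≥ x with f y ∈ K (so y ∉ B); such y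
-- are found by search because B is infinite (A is not recursive) and f⁻¹(K) is infinite. A fibre
-- of g then consists of points below n₀, at most one first occurrence of an h-value, and
-- points x with x ≤ g x, so it is finite.
module Submission where

open import Defs
open import Level using (0ℓ)
open import Axiom.ExcludedMiddle using (ExcludedMiddle)
open import Function using (_∘_; id; case_of_)
open import Data.Nat
  using (ℕ; zero; suc; _+_; _*_; _∸_; _≤_; _<_; _≟_; z≤n; s≤s; pred; _⊔_; ∣_-_∣; ≢-nonZero)
open import Data.Nat.Properties
open import Data.Fin using (Fin; _↑ʳ_; #_) renaming (zero to fzero; suc to fsuc)
open import Data.Vec using (Vec; []; _∷_; lookup; map; tabulate; head; tail; drop)
open import Data.Vec.Properties using (tabulate∘lookup; tabulate-cong; map-∘; map-id)
open import Data.Product using (Σ; ∃; _×_; _,_; proj₁; proj₂)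
open import Data.Sum using (_⊎_; inj₁; inj₂)
open import Data.Empty using (⊥-elim)
open import Relation.Nullary using (¬_; Dec; yes; no; contradiction)
open import Relation.Binary.PropositionalEquality
open ≡-Reasoning

private
  variable
    n m : ℕ

Computableⁿ : ∀ n → (Vec ℕ n → ℕ) → Set
Computableⁿ n F = Σ (PR n) λ e → ∀ xs → Eval e xs (F xs)

ComputableVec : ∀ n m → (Vec ℕ n → Vec ℕ m) → Set
ComputableVec n m G = Σ (Vec (PR n) m) λ es → ∀ xs → EvalAll es xs (G xs)

uncurry₁ : (ℕ → ℕ) → Vec ℕ 1 → ℕ
uncurry₁ f (x ∷ []) = f x

uncurry₂ : (ℕ → ℕ → ℕ) → Vec ℕ 2 → ℕ
uncurry₂ f (x ∷ y ∷ []) = f x y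

uncurry₃ : (ℕ → ℕ → ℕ → ℕ) → Vec ℕ 3 → ℕ
uncurry₃ f (x ∷ y ∷ z ∷ []) = f x y z

Computable₁ : (ℕ → ℕ) → Set
Computable₁ f = Computableⁿ 1 (uncurry₁ f)

Computable₂ : (ℕ → ℕ → ℕ) → Set
Computable₂ f = Computableⁿ 2 (uncurry₂ f)

Computable₃ : (ℕ → ℕ → ℕ → ℕ) → Set
Computable₃ f = Computableⁿ 3 (uncurry₃ f)

computable⇒computable₁ : ∀ {f} → Computable f → Computable₁ f
computable⇒computable₁ (e , eval) = e , λ { (x ∷ []) → eval x }

computable₁⇒computable : ∀ {f} → Computable₁ f → Computable f
computable₁⇒computable (e , eval) = e , λ x → eval (x ∷ [])

computable-cong : ∀ {F G : Vec ℕ n → ℕ} →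
                  Computableⁿ n F → (∀ xs → F xs ≡ G xs) → Computableⁿ n G
computable-cong (e , eval) F≗G = e , λ xs → subst (Eval e xs) (F≗G xs) (eval xs)

computableVec-cong : ∀ {F G : Vec ℕ n → Vec ℕ m} →
                     ComputableVec n m F → (∀ xs → F xs ≡ G xs) → ComputableVec n m G
computableVec-cong (es , eval) F≗G = es , λ xs → subst (EvalAll es xs) (F≗G xs) (eval xs)

computable-∘ : ∀ {F : Vec ℕ m → ℕ} {G : Vec ℕ n → Vec ℕ m} →
               Computableⁿ m F → ComputableVec n m G → Computableⁿ n (F ∘ G)
computable-∘ {G = G} (e , eval) (es , evalAll) = comp e es , λ xs → ecomp (evalAll xs) (eval (G xs))

[]ᶜ : ComputableVec n 0 (λ _ → [])
[]ᶜ = [] , λ _ → []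

infixr 5 _∷ᶜ_
_∷ᶜ_ : ∀ {F : Vec ℕ n → ℕ} {G : Vec ℕ n → Vec ℕ m} →
       Computableⁿ n F → ComputableVec n m G → ComputableVec n (suc m) (λ xs → F xs ∷ G xs)
(e , eval) ∷ᶜ (es , evalAll) = e ∷ es , λ xs → eval xs ∷ evalAll xs

compose₁ : ∀ {f G} → Computable₁ f → Computableⁿ n G → Computableⁿ n (f ∘ G)
compose₁ cf cG = computable-∘ cf (cG ∷ᶜ []ᶜ)

compose₂ : ∀ {f G₁ G₂} → Computable₂ f → Computableⁿ n G₁ → Computableⁿ n G₂ →
           Computableⁿ n (λ xs → f (G₁ xs) (G₂ xs))
compose₂ cf cG₁ cG₂ = computable-∘ cf (cG₁ ∷ᶜ cG₂ ∷ᶜ []ᶜ)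

compose₃ : ∀ {f G₁ G₂ G₃} → Computable₃ f →
           Computableⁿ n G₁ → Computableⁿ n G₂ → Computableⁿ n G₃ →
           Computableⁿ n (λ xs → f (G₁ xs) (G₂ xs) (G₃ xs))
compose₃ cf cG₁ cG₂ cG₃ = computable-∘ cf (cG₁ ∷ᶜ cG₂ ∷ᶜ cG₃ ∷ᶜ []ᶜ)

computable-suc : Computable₁ suc
computable-suc = S , λ { (x ∷ []) → eS }

constᶜ : ∀ k → Computableⁿ n (λ _ → k)
constᶜ zero    = Z , λ _ → eZ
constᶜ (suc k) = compose₁ computable-suc (constᶜ k)

lookupᶜ : ∀ i → Computableⁿ n (λ xs → lookup xs i)
lookupᶜ i = P i , λ _ → eP i

computable-tabulate-lookup : (ρ : Fin m → Fin n) →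
                             ComputableVec n m (λ xs → tabulate (lookup xs ∘ ρ))
computable-tabulate-lookup {zero}  ρ = []ᶜ
computable-tabulate-lookup {suc m} ρ = lookupᶜ (ρ fzero) ∷ᶜ computable-tabulate-lookup (ρ ∘ fsuc)

lookup-↑ʳ : ∀ k (xs : Vec ℕ (k + n)) i → lookup xs (k ↑ʳ i) ≡ lookup (drop k xs) i
lookup-↑ʳ zero    xs       i = refl
lookup-↑ʳ (suc k) (x ∷ xs) i = lookup-↑ʳ k xs i

dropᶜ : ∀ k → ComputableVec (k + n) n (drop k)
dropᶜ k = computableVec-cong (computable-tabulate-lookup (k ↑ʳ_)) λ xs →
  trans (tabulate-cong (lookup-↑ʳ k xs)) (tabulate∘lookup (drop k xs))

primRec : (Vec ℕ n → ℕ) → (Vec ℕ (2 + n) → ℕ) → Vec ℕ (suc n) → ℕ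
primRec G H (zero  ∷ xs) = G xs
primRec G H (suc y ∷ xs) = H (y ∷ primRec G H (y ∷ xs) ∷ xs)

computable-primRec : ∀ {G H} → Computableⁿ n G → Computableⁿ (2 + n) H →
                     Computableⁿ (suc n) (primRec G H)
computable-primRec {G = G} {H} (g , evalG) (t , evalH) = prec g t , eval
  where
  eval : ∀ xs → Eval (prec g t) xs (primRec G H xs)
  eval (zero  ∷ xs) = eprecZ (evalG xs)
  eval (suc y ∷ xs) = eprecS (eval (y ∷ xs)) (evalH _)

computable-+ : Computable₂ _+_
computable-+ = computable-cong
  (computable-primRec (lookupᶜ (# 0)) (compose₁ computable-suc (lookupᶜ (# 1))))
  λ { (a ∷ b ∷ []) → plus a b }
  where
  plus : ∀ a b →
         primRec (λ xs → lookup xs (# 0)) (λ xs → suc (lookup xs (# 1))) (a ∷ b ∷ []) ≡ a + b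
  plus zero    b = refl
  plus (suc a) b = cong suc (plus a b)

computable-* : Computable₂ _*_
computable-* = computable-cong
  (computable-primRec (constᶜ 0) (compose₂ computable-+ (lookupᶜ (# 2)) (lookupᶜ (# 1))))
  λ { (a ∷ b ∷ []) → times a b }
  where
  times : ∀ a b →
          primRec (λ _ → 0) (λ xs → lookup xs (# 2) + lookup xs (# 1)) (a ∷ b ∷ []) ≡ a * b
  times zero    b = refl
  times (suc a) b = cong (b +_) (times a b)

computable-pred : Computable₁ pred
computable-pred = computable-cong (computable-primRec (constᶜ 0) (lookupᶜ (# 0)))
  λ { (zero ∷ []) → refl ; (suc a ∷ []) → refl }

computable-∸ : Computable₂ _∸_
computable-∸ = computable-cong
  (computable-∘ (computable-primRec (lookupᶜ (# 0)) (compose₁ computable-pred (lookupᶜ (# 1))))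
                (lookupᶜ (# 1) ∷ᶜ lookupᶜ (# 0) ∷ᶜ []ᶜ))
  λ { (a ∷ b ∷ []) → monus a b }
  where
  monus : ∀ a b →
          primRec (λ xs → lookup xs (# 0)) (λ xs → pred (lookup xs (# 1))) (b ∷ a ∷ []) ≡ a ∸ b
  monus a zero    = refl
  monus a (suc b) = trans (cong pred (monus a b)) (pred[m∸n]≡m∸[1+n] a b)

∣m-n∣≡[m∸n]+[n∸m] : ∀ m n → ∣ m - n ∣ ≡ (m ∸ n) + (n ∸ m)
∣m-n∣≡[m∸n]+[n∸m] zero    zero    = refl
∣m-n∣≡[m∸n]+[n∸m] zero    (suc n) = refl
∣m-n∣≡[m∸n]+[n∸m] (suc m) zero    = sym (+-identityʳ (suc m))
∣m-n∣≡[m∸n]+[n∸m] (suc m) (suc n) = ∣m-n∣≡[m∸n]+[n∸m] m n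

computable-∣-∣ : Computable₂ ∣_-_∣
computable-∣-∣ = computable-cong
  (compose₂ computable-+ (compose₂ computable-∸ (lookupᶜ (# 0)) (lookupᶜ (# 1)))
                         (compose₂ computable-∸ (lookupᶜ (# 1)) (lookupᶜ (# 0))))
  λ { (a ∷ b ∷ []) → sym (∣m-n∣≡[m∸n]+[n∸m] a b) }

if0_then_else_ : ℕ → ℕ → ℕ → ℕ
if0 zero  then a else b = a
if0 suc _ then a else b = b

if0-≢0 : ∀ {c} a b → c ≢ 0 → (if0 c then a else b) ≡ b
if0-≢0 {zero}  _ _ c≢0 = contradiction refl c≢0
if0-≢0 {suc _} _ _ _   = refl

if0-elim : ∀ {P : ℕ → Set} c {a b} → P a → P b → P (if0 c then a else b)
if0-elim zero    Pa _  = Pa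
if0-elim (suc _) _  Pb = Pb

computable-if0 : Computable₃ if0_then_else_
computable-if0 = computable-cong (computable-primRec (lookupᶜ (# 0)) (lookupᶜ (# 3)))
  λ { (zero ∷ a ∷ b ∷ []) → refl ; (suc c ∷ a ∷ b ∷ []) → refl }

if1_then_else_ : ℕ → ℕ → ℕ → ℕ
if1 c then a else b = if0 c then b else (if0 pred c then a else b)

computable-if1 : Computable₃ if1_then_else_
computable-if1 = computable-cong
  (compose₃ computable-if0 (lookupᶜ (# 0)) (lookupᶜ (# 2))
    (compose₃ computable-if0 (compose₁ computable-pred (lookupᶜ (# 0)))
                             (lookupᶜ (# 1)) (lookupᶜ (# 2))))
  λ { (c ∷ a ∷ b ∷ []) → refl }

-- The least z < b with c z ≡ 0, or b if there is none.
leastZero : (ℕ → ℕ) → ℕ → ℕ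
leastZero c zero = zero
leastZero c (suc b) with c (leastZero c b)
... | zero  = leastZero c b
... | suc _ = suc b

module _ (c : ℕ → ℕ) where

  leastZero-≤ : ∀ b → leastZero c b ≤ b
  leastZero-≤ zero = z≤n
  leastZero-≤ (suc b) with c (leastZero c b)
  ... | zero  = m≤n⇒m≤1+n (leastZero-≤ b)
  ... | suc _ = ≤-refl

  leastZero-zero : ∀ {b z} → z ≤ b → c z ≡ 0 → c (leastZero c b) ≡ 0
  leastZero-zero {zero}  z≤n  cz≡0 = cz≡0
  leastZero-zero {suc b} z≤b cz≡0 with c (leastZero c b) in eq
  ... | zero  = eq
  ... | suc _ with m≤n⇒m<n∨m≡n z≤b
  ...   | inj₁ z<b  = contradiction (trans (sym (leastZero-zero (≤-pred z<b) cz≡0)) eq) 0≢1+n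
  ...   | inj₂ refl = cz≡0

  leastZero-found : ∀ {b} → leastZero c b < b → c (leastZero c b) ≡ 0
  leastZero-found {suc b} lz<b with c (leastZero c b) in eq
  ... | zero  = eq
  ... | suc _ = contradiction lz<b (n≮n (suc b))

  leastZero-minimal : ∀ {b z} → z < leastZero c b → c z ≢ 0
  leastZero-minimal {suc b} {z} z<lz cz≡0 with c (leastZero c b) in eq
  ... | zero  = leastZero-minimal {b} z<lz cz≡0
  ... | suc _ = 0≢1+n (trans (sym (leastZero-zero (≤-pred z<lz) cz≡0)) eq)

  leastZero-≤-zero : ∀ {b z} → c z ≡ 0 → leastZero c b ≤ z
  leastZero-≤-zero {b} cz≡0 = ≮⇒≥ (λ z<lz → leastZero-minimal {b} z<lz cz≡0)

  leastZero-least : ∀ {b z} → z < b → c z ≡ 0 → (∀ {y} → y < z → c y ≢ 0) →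
                    leastZero c b ≡ z
  leastZero-least {b} {z} z<b cz≡0 nonzero-below = ≤-antisym lz≤z
    (≮⇒≥ λ lz<z → nonzero-below lz<z (leastZero-found {b} (≤-<-trans lz≤z z<b)))
    where
    lz≤z : leastZero c b ≤ z
    lz≤z = leastZero-≤-zero {b} cz≡0

leastZero-mono : ∀ c d {b} → (∀ {z} → z < b → d z ≡ 0 → c z ≡ 0) →
                 leastZero c b ≤ leastZero d b
leastZero-mono c d {b} d⇒c with m≤n⇒m<n∨m≡n (leastZero-≤ d b)
... | inj₁ lz<b = leastZero-≤-zero c {b} (d⇒c lz<b (leastZero-found d {b} lz<b))
... | inj₂ lz≡b = subst (leastZero c b ≤_) (sym lz≡b) (leastZero-≤ c b)

-- Weighting by b ∸ z gives c a zero at b, as unbounded μ needs, without changing its zeros below b.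
leastZero-weighted : ∀ c b → leastZero (λ z → (b ∸ z) * c z) b ≡ leastZero c b
leastZero-weighted c b = ≤-antisym
  (leastZero-mono weighted c {b} λ {z} _ cz≡0 → trans (cong ((b ∸ z) *_) cz≡0) (*-zeroʳ (b ∸ z)))
  (leastZero-mono c weighted {b} λ {z} z<b weighted≡0 →
     case m*n≡0⇒m≡0∨n≡0 (b ∸ z) weighted≡0 of λ where
       (inj₁ b∸z≡0) → contradiction b∸z≡0 (m>n⇒m∸n≢0 z<b)
       (inj₂ cz≡0)  → cz≡0)
  where
  weighted : ℕ → ℕ
  weighted z = (b ∸ z) * c z

-- The bound only certifies that the unbounded search of μ terminates; it need not be computable.
computable-μ : ∀ {C : Vec ℕ (suc n) → ℕ} → Computableⁿ (suc n) C →
               (bound : Vec ℕ n → ℕ) → (∀ xs → C (bound xs ∷ xs) ≡ 0) →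
               Computableⁿ n (λ xs → leastZero (λ z → C (z ∷ xs)) (bound xs))
computable-μ {n} {C} (e , eval) bound root = mu e , λ xs →
  emu (evalAt (leastZero-zero (C′ xs) {bound xs} ≤-refl (root xs)))
      (λ z z<lz → evalAt-nonzero (leastZero-minimal (C′ xs) {bound xs} z<lz))
  where
  C′ : Vec ℕ n → ℕ → ℕ
  C′ xs z = C (z ∷ xs)
  evalAt : ∀ {z xs r} → C (z ∷ xs) ≡ r → Eval e (z ∷ xs) r
  evalAt {z} {xs} refl = eval (z ∷ xs)
  evalAt-nonzero : ∀ {z xs} → C (z ∷ xs) ≢ 0 → Σ ℕ λ k → Eval e (z ∷ xs) (suc k)
  evalAt-nonzero {z} {xs} Cz≢0 with C (z ∷ xs) in eq
  ... | zero  = contradiction refl Cz≢0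
  ... | suc k = k , evalAt eq

computable-leastZero : ∀ {C : Vec ℕ (2 + n) → ℕ} → Computableⁿ (2 + n) C →
                       Computableⁿ (suc n) (λ xs → leastZero (λ z → C (z ∷ xs)) (head xs))
computable-leastZero {C = C} cC = computable-cong
  (computable-μ (compose₂ computable-* (compose₂ computable-∸ (lookupᶜ (# 1)) (lookupᶜ (# 0))) cC) head
                λ { (b ∷ xs) → cong (_* C (b ∷ b ∷ xs)) (n∸n≡0 b) })
  λ { (b ∷ xs) → leastZero-weighted (λ z → C (z ∷ b ∷ xs)) b }

allPositive : Vec ℕ m → ℕ
allPositive []       = 1
allPositive (y ∷ ys) = if0 y then 0 else allPositive ys

-- approx e s xs is suc r if e converges on xs to r when every μ-search is cut off at s, and 0 otherwise.
mutual
  approx : PR n → ℕ → Vec ℕ n → ℕ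
  approx Z           s xs       = 1
  approx S           s xs       = suc (suc (head xs))
  approx (P i)       s xs       = suc (lookup xs i)
  approx (comp f gs) s xs       =
    if0 allPositive (approxAll gs s xs) then 0 else approx f s (map pred (approxAll gs s xs))
  approx (prec g t)  s (y ∷ xs) = approxPrec g t s y xs
  approx (mu f)      s xs       =
    if1 approx f s (μ-candidate f s xs ∷ xs) then suc (μ-candidate f s xs) else 0

  approxAll : Vec (PR n) m → ℕ → Vec ℕ n → Vec ℕ m
  approxAll []       s xs = []
  approxAll (g ∷ gs) s xs = approx g s xs ∷ approxAll gs s xs

  approxPrec : PR n → PR (2 + n) → ℕ → ℕ → Vec ℕ n → ℕ
  approxPrec g t s zero    xs = approx g s xs
  approxPrec g t s (suc y) xs =
    if0 approxPrec g t s y xs then 0 else approx t s (y ∷ pred (approxPrec g t s y xs) ∷ xs)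

  -- The least z < s at which f has not converged or has converged to 0.
  μ-candidate : PR (suc n) → ℕ → Vec ℕ n → ℕ
  μ-candidate f s xs = leastZero (λ z → pred (approx f s (z ∷ xs))) s

mutual
  approx-sound : ∀ (e : PR n) {s xs r} → approx e s xs ≡ suc r → Eval e xs r
  approx-sound Z refl = eZ
  approx-sound S {xs = x ∷ []} refl = eS
  approx-sound (P i) refl = eP i
  approx-sound (comp f gs) {s} {xs} eq with allPositive (approxAll gs s xs) in positive
  ... | zero  = ⊥-elim (0≢1+n eq)
  ... | suc _ = ecomp (approxAll-sound gs positive) (approx-sound f eq)
  approx-sound (prec g t) {xs = y ∷ xs} eq = approxPrec-sound g t y eq
  approx-sound (mu f) {s} {xs} eq with approx f s (μ-candidate f s xs ∷ xs) in converged
  ... | zero        = ⊥-elim (0≢1+n eq)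
  ... | suc (suc _) = ⊥-elim (0≢1+n eq)
  ... | suc zero    = subst (Eval (mu f) xs) (suc-injective eq)
    (emu (approx-sound f converged) λ z z<c → approx-converges-positive f (leastZero-minimal _ {s} z<c))

  approxAll-sound : ∀ (gs : Vec (PR n) m) {s xs k} → allPositive (approxAll gs s xs) ≡ suc k →
                    EvalAll gs xs (map pred (approxAll gs s xs))
  approxAll-sound []                 _        = []
  approxAll-sound (g ∷ gs) {s} {xs} positive with approx g s xs in eq
  ... | suc _ = approx-sound g eq ∷ approxAll-sound gs positive

  approxPrec-sound : ∀ (g : PR n) t {s} y {xs r} → approxPrec g t s y xs ≡ suc r →
                     Eval (prec g t) (y ∷ xs) r
  approxPrec-sound g t zero    eq = eprecZ (approx-sound g eq)
  approxPrec-sound g t {s} (suc y) {xs} eq with approxPrec g t s y xs in previous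
  ... | zero  = ⊥-elim (0≢1+n eq)
  ... | suc _ = eprecS (approxPrec-sound g t y previous) (approx-sound t eq)

  approx-converges-positive : ∀ (f : PR n) {s xs} → pred (approx f s xs) ≢ 0 →
                              Σ ℕ λ k → Eval f xs (suc k)
  approx-converges-positive f {s} {xs} pred≢0 with approx f s xs in eq
  ... | zero        = contradiction refl pred≢0
  ... | suc zero    = contradiction refl pred≢0
  ... | suc (suc k) = k , approx-sound f eq

Eventually : (ℕ → Set) → Set
Eventually Q = Σ ℕ λ s₀ → ∀ {s} → s₀ ≤ s → Q s

module _ {P₁ P₂ : ℕ → Set} where

  eventually-map : (∀ {s} → P₁ s → P₂ s) → Eventually P₁ → Eventually P₂
  eventually-map P₁⇒P₂ (s₀ , p) = s₀ , P₁⇒P₂ ∘ p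

  eventually-× : Eventually P₁ → Eventually P₂ → Eventually (λ s → P₁ s × P₂ s)
  eventually-× (s₁ , p) (s₂ , q) =
    s₁ ⊔ s₂ , λ le → p (m⊔n≤o⇒m≤o s₁ s₂ le) , q (m⊔n≤o⇒n≤o s₁ s₂ le)

eventually-≥ : ∀ n → Eventually (n ≤_)
eventually-≥ n = n , λ le → le

eventually-∀< : ∀ {Q : ℕ → ℕ → Set} y → (∀ z → z < y → Eventually (Q z)) →
                Eventually (λ s → ∀ z → z < y → Q z s)
eventually-∀< zero    _  = 0 , λ _ _ ()
eventually-∀< {Q} (suc y) ev = eventually-map below-suc
  (eventually-× (eventually-∀< y (λ z z<y → ev z (m<n⇒m<1+n z<y))) (ev y ≤-refl))
  where
  below-suc : ∀ {s} → (∀ z → z < y → Q z s) × Q y s → ∀ z → z < suc y → Q z s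
  below-suc (below , at) z z<1+y with m≤n⇒m<n∨m≡n (≤-pred z<1+y)
  ... | inj₁ z<y  = below z z<y
  ... | inj₂ refl = at

allPositive-map-suc : ∀ (ys : Vec ℕ m) → allPositive (map suc ys) ≡ 1
allPositive-map-suc []       = refl
allPositive-map-suc (y ∷ ys) = allPositive-map-suc ys

mutual
  approx-complete : ∀ {e : PR n} {xs r} → Eval e xs r → Eventually (λ s → approx e s xs ≡ suc r)
  approx-complete eZ     = 0 , λ _ → refl
  approx-complete eS     = 0 , λ _ → refl
  approx-complete (eP i) = 0 , λ _ → refl
  approx-complete {e = comp f gs} {xs} {r} (ecomp {ys = ys} evalAll eval) =
    eventually-map compose (eventually-× (approxAll-complete evalAll) (approx-complete eval))
    where
    compose : ∀ {s} → approxAll gs s xs ≡ map suc ys × approx f s ys ≡ suc r →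
              approx (comp f gs) s xs ≡ suc r
    compose {s} (args , result) = begin
      if0 allPositive (approxAll gs s xs) then 0 else approx f s (map pred (approxAll gs s xs))
        ≡⟨ cong (λ v → if0 allPositive v then 0 else approx f s (map pred v)) args ⟩
      if0 allPositive (map suc ys) then 0 else approx f s (map pred (map suc ys))
        ≡⟨ cong₂ (λ a v → if0 a then 0 else approx f s v)
                 (allPositive-map-suc ys) (sym (map-∘ pred suc ys)) ⟩
      approx f s (map id ys)
        ≡⟨ cong (approx f s) (map-id ys) ⟩
      approx f s ys
        ≡⟨ result ⟩
      suc r ∎
  approx-complete (eprecZ eval) = approx-complete eval
  approx-complete {e = prec g t} {xs = _ ∷ xs} (eprecS {y = y} previous step) =
    eventually-map compose (eventually-× (approx-complete previous) (approx-complete step))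
    where
    compose : ∀ {s r r′} →
              approxPrec g t s y xs ≡ suc r × approx t s (y ∷ r ∷ xs) ≡ suc r′ →
              approxPrec g t s (suc y) xs ≡ suc r′
    compose (prev , result) rewrite prev = result
  approx-complete {e = mu f} {xs} (emu {y = y} root below) =
    eventually-map compose
      (eventually-× (approx-complete root)
        (eventually-× (eventually-∀< y λ z z<y →
                         eventually-map converged (approx-complete (proj₂ (below z z<y))))
                      (eventually-≥ (suc y))))
    where
    converged : ∀ {s z k} → approx f s (z ∷ xs) ≡ suc (suc k) → pred (approx f s (z ∷ xs)) ≢ 0
    converged eq rewrite eq = λ ()
    compose : ∀ {s} →
              approx f s (y ∷ xs) ≡ 1 × (∀ z → z < y → pred (approx f s (z ∷ xs)) ≢ 0) × y < s →
              approx (mu f) s xs ≡ suc y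
    compose {s} (at-root , before-root , y<s)
      rewrite leastZero-least (λ z → pred (approx f s (z ∷ xs))) y<s (cong pred at-root) (before-root _)
            | at-root = refl

  approxAll-complete : ∀ {gs : Vec (PR n) m} {xs ys} → EvalAll gs xs ys →
                       Eventually (λ s → approxAll gs s xs ≡ map suc ys)
  approxAll-complete []             = 0 , λ _ → refl
  approxAll-complete (eval ∷ evals) = eventually-map (λ (e , es) → cong₂ _∷_ e es)
    (eventually-× (approx-complete eval) (approxAll-complete evals))

computableVec-map : ∀ {f} {G : Vec ℕ n → Vec ℕ m} → Computable₁ f → ComputableVec n m G →
                    ComputableVec n m (map f ∘ G)
computableVec-map {n} {f = f} (e , eval) (es , evalAll) =
  map (λ g → comp e (g ∷ [])) es , evalAll-map ∘ evalAll
  where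
  evalAll-map : ∀ {m} {gs : Vec (PR n) m} {xs ys} → EvalAll gs xs ys →
                EvalAll (map (λ g → comp e (g ∷ [])) gs) xs (map f ys)
  evalAll-map []         = []
  evalAll-map (ev ∷ evs) = ecomp (ev ∷ []) (eval (_ ∷ [])) ∷ evalAll-map evs

computable-allPositive : ∀ m → Computableⁿ m allPositive
computable-allPositive zero    = computable-cong (constᶜ 1) λ { [] → refl }
computable-allPositive (suc m) = computable-cong
  (compose₃ computable-if0 (lookupᶜ (# 0)) (constᶜ 0)
            (computable-∘ (computable-allPositive m) (dropᶜ 1)))
  λ { (y ∷ ys) → refl }

approxPrecStep : PR (2 + n) → Vec ℕ (3 + n) → ℕ
approxPrecStep t (y ∷ r ∷ s ∷ xs) = if0 r then 0 else approx t s (y ∷ pred r ∷ xs)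

mutual
  approx-computable : ∀ (e : PR n) → Computableⁿ (suc n) (λ xs → approx e (head xs) (tail xs))
  approx-computable Z = computable-cong (constᶜ 1) λ { (s ∷ xs) → refl }
  approx-computable S = computable-cong
    (compose₁ computable-suc (compose₁ computable-suc (lookupᶜ (# 1))))
    λ { (s ∷ x ∷ []) → refl }
  approx-computable (P i) = computable-cong
    (compose₁ computable-suc (lookupᶜ (fsuc i)))
    λ { (s ∷ xs) → refl }
  approx-computable (comp f gs) = computable-cong
    (compose₃ computable-if0
      (computable-∘ (computable-allPositive _) (approxAll-computable gs))
      (constᶜ 0)
      (computable-∘ (approx-computable f)
                    (lookupᶜ (# 0) ∷ᶜ computableVec-map computable-pred (approxAll-computable gs))))
    λ { (s ∷ xs) → refl }
  approx-computable (prec g t) = computable-cong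
    (computable-∘ (computable-primRec (approx-computable g) (approxPrecStep-computable t))
                  (lookupᶜ (# 1) ∷ᶜ lookupᶜ (# 0) ∷ᶜ dropᶜ 2))
    λ { (s ∷ y ∷ xs) → primRec-approxPrec y }
    where
    primRec-approxPrec : ∀ {s xs} y →
      primRec (λ xs → approx g (head xs) (tail xs)) (approxPrecStep t) (y ∷ s ∷ xs)
        ≡ approxPrec g t s y xs
    primRec-approxPrec zero    = refl
    primRec-approxPrec (suc y) =
      cong (λ r → if0 r then 0 else approx t _ (y ∷ pred r ∷ _)) (primRec-approxPrec y)
  approx-computable (mu f) = computable-cong
    (compose₃ computable-if1
      (computable-∘ (approx-computable f)
                    (lookupᶜ (# 0) ∷ᶜ μ-candidate-computable f ∷ᶜ dropᶜ 1))
      (compose₁ computable-suc (μ-candidate-computable f))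
      (constᶜ 0))
    λ { (s ∷ xs) → refl }

  approxAll-computable : ∀ (gs : Vec (PR n) m) →
                         ComputableVec (suc n) m (λ xs → approxAll gs (head xs) (tail xs))
  approxAll-computable []       = computableVec-cong []ᶜ λ { (s ∷ xs) → refl }
  approxAll-computable (g ∷ gs) = computableVec-cong (approx-computable g ∷ᶜ approxAll-computable gs)
    λ { (s ∷ xs) → refl }

  approxPrecStep-computable : ∀ (t : PR (2 + n)) → Computableⁿ (3 + n) (approxPrecStep t)
  approxPrecStep-computable t = computable-cong
    (compose₃ computable-if0 (lookupᶜ (# 1)) (constᶜ 0)
      (computable-∘ (approx-computable t)
        (lookupᶜ (# 2) ∷ᶜ lookupᶜ (# 0) ∷ᶜ compose₁ computable-pred (lookupᶜ (# 1)) ∷ᶜ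
         dropᶜ 3)))
    λ { (y ∷ r ∷ s ∷ xs) → refl }

  μ-candidate-computable : ∀ (f : PR (suc n)) →
                           Computableⁿ (suc n) (λ xs → μ-candidate f (head xs) (tail xs))
  μ-candidate-computable f = computable-cong
    (computable-leastZero (compose₁ computable-pred
      (computable-∘ (approx-computable f) (lookupᶜ (# 1) ∷ᶜ lookupᶜ (# 0) ∷ᶜ dropᶜ 2))))
    λ { (s ∷ xs) → refl }

record Enumeration (X : Subset) : Set where
  field
    enumerated : ℕ → ℕ → ℕ
    computable : Computable₂ enumerated
    sound      : ∀ {s x} → enumerated s x ≢ 0 → X x
    complete   : ∀ {x} → X x → Eventually (λ s → enumerated s x ≢ 0)

ce⇒enumeration : ∀ {X} → CE X → Enumeration X
ce⇒enumeration (e , domain) = record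
  { enumerated = λ s x → approx e s (x ∷ [])
  ; computable = computable-cong (approx-computable e) λ { (s ∷ x ∷ []) → refl }
  ; sound      = λ {s} {x} converged →
      proj₂ (domain x) (_ , approx-sound e (sym (suc-pred _ {{≢-nonZero converged}})))
  ; complete   = λ {x} Xx → eventually-map (λ eq eq0 → 0≢1+n (trans (sym eq0) eq))
                                           (approx-complete (proj₂ (proj₁ (domain x) Xx)))
  }

enumeration-∘ : ∀ {X g} → Enumeration X → Computable₁ g → Enumeration (X ∘ g)
enumeration-∘ {g = g} E cg = record
  { enumerated = λ s x → enumerated s (g x)
  ; computable = computable-cong (compose₂ computable (lookupᶜ (# 0)) (compose₁ cg (lookupᶜ (# 1))))
                   λ { (s ∷ x ∷ []) → refl }
  ; sound      = sound
  ; complete   = complete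
  }
  where open Enumeration E

Unbounded : Subset → Set
Unbounded X = ∀ x → ∃ λ y → x ≤ y × X y

record ComputablyUnbounded (X : Subset) : Set where
  field
    select     : ℕ → ℕ
    computable : Computable₁ select
    above      : ∀ x → x ≤ select x
    member     : ∀ x → X (select x)

infinite⇒unbounded : ExcludedMiddle 0ℓ → ∀ {X} → Infinite X → Unbounded X
infinite⇒unbounded em {X} infinite x with em {∃ λ y → x ≤ y × X y}
... | yes above = above
... | no  none  = ⊥-elim (infinite (x , λ y Xy → ≰⇒> λ x≤y → none (y , x≤y , Xy)))

computablyUnbounded-mono : ∀ {X Y} → (∀ {x} → X x → Y x) →
                           ComputablyUnbounded X → ComputablyUnbounded Y
computablyUnbounded-mono X⊆Y U = record
  { select = select ; computable = computable ; above = above ; member = X⊆Y ∘ member }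
  where open ComputablyUnbounded U

module _ {X : Subset} (E : Enumeration X) (unbounded : Unbounded X) where
  open Enumeration E

  -- hit c x y ≡ 0 iff x ≤ y and y is enumerated by stage c.
  private
    hit : ℕ → ℕ → ℕ → ℕ
    hit c x y = if0 enumerated c y then 1 else (x ∸ y)

    candidate : ℕ → ℕ → ℕ
    candidate c x = leastZero (hit c x) c

    hit⇒above-enumerated : ∀ {c x y} → hit c x y ≡ 0 → x ≤ y × enumerated c y ≢ 0
    hit⇒above-enumerated {c} {x} {y} hit≡0 with enumerated c y
    ... | suc _ = m∸n≡0⇒m≤n hit≡0 , λ ()

    -- Any stage past both y and the enumeration of y, for some y ≥ x in X, has a hit.
    good-stage : ∀ x → ∃ λ c → hit c x (candidate c x) ≡ 0
    good-stage x =
      let (y , x≤y , Xy) = unbounded x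
          (s₀ , enumerated-y) = complete Xy
      in hit-below (m≤n⊔m s₀ (suc y))
           (trans (if0-≢0 1 (x ∸ y) (enumerated-y (m≤m⊔n s₀ (suc y)))) (m≤n⇒m∸n≡0 x≤y))
      where
      hit-below : ∀ {c y} → y < c → hit c x y ≡ 0 → ∃ λ c → hit c x (candidate c x) ≡ 0
      hit-below {c} y<c hit≡0 =
        c , leastZero-found (hit c x) (≤-<-trans (leastZero-≤-zero (hit c x) {c} hit≡0) y<c)

    stage : ℕ → ℕ
    stage x = leastZero (λ c → hit c x (candidate c x)) (proj₁ (good-stage x))

    selectAbove : ℕ → ℕ
    selectAbove x = candidate (stage x) x

    computable-hit : Computable₃ hit
    computable-hit = computable-cong
      (compose₃ computable-if0
        (compose₂ computable (lookupᶜ (# 0)) (lookupᶜ (# 2)))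
        (constᶜ 1)
        (compose₂ computable-∸ (lookupᶜ (# 1)) (lookupᶜ (# 2))))
      λ { (c ∷ x ∷ y ∷ []) → refl }

    computable-candidate : Computable₂ candidate
    computable-candidate = computable-cong
      (computable-leastZero (compose₃ computable-hit (lookupᶜ (# 1)) (lookupᶜ (# 2)) (lookupᶜ (# 0))))
      λ { (c ∷ x ∷ []) → refl }

    computable-selectAbove : Computable₁ selectAbove
    computable-selectAbove = computable-cong
      (compose₂ computable-candidate
        (computable-μ (compose₃ computable-hit (lookupᶜ (# 0)) (lookupᶜ (# 1))
                                (compose₂ computable-candidate (lookupᶜ (# 0)) (lookupᶜ (# 1))))
                      (λ { (x ∷ []) → proj₁ (good-stage x) })
                      λ { (x ∷ []) → proj₂ (good-stage x) })
        (lookupᶜ (# 0)))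
      λ { (x ∷ []) → refl }

    hit-selectAbove : ∀ x → x ≤ selectAbove x × enumerated (stage x) (selectAbove x) ≢ 0
    hit-selectAbove x = hit⇒above-enumerated
      (leastZero-zero (λ c → hit c x (candidate c x)) ≤-refl (proj₂ (good-stage x)))

  enumeration⇒computablyUnbounded : ComputablyUnbounded X
  enumeration⇒computablyUnbounded = record
    { select     = selectAbove
    ; computable = computable-selectAbove
    ; above      = proj₁ ∘ hit-selectAbove
    ; member     = sound ∘ proj₂ ∘ hit-selectAbove
    }

computable-∘₁ : ∀ {f g} → Computable f → Computable g → Computable (f ∘ g)
computable-∘₁ {g = g} (e , eval) (e′ , eval′) =
  comp e (e′ ∷ []) , λ x → ecomp (eval′ x ∷ []) (eval (g x))

recursive-cong : ∀ {X Y} → (∀ x → X x ⇔' Y x) → Recursive X → Recursive Y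
recursive-cong X⇔Y (χ , cχ , χ-spec) = χ , cχ , λ x →
  proj₁ (χ-spec x) ∘ proj₂ (X⇔Y x) , proj₁ (X⇔Y x) ∘ proj₂ (χ-spec x)

≤m⇒recursive : ∀ {X Y} → X ≤m Y → Recursive Y → Recursive X
≤m⇒recursive (h , ch , h-reduction) (χ , cχ , χ-spec) = χ ∘ h , computable-∘₁ cχ ch , λ x →
  proj₁ (χ-spec (h x)) ∘ proj₁ (h-reduction x) , proj₂ (h-reduction x) ∘ proj₂ (χ-spec (h x))

module _ (em : ExcludedMiddle 0ℓ) {X : Subset} where

  recursive-below : ∀ i → Recursive (λ x → x < i × X x)
  recursive-below zero =
    (λ _ → 1) , computable₁⇒computable (computable-cong (constᶜ 1) λ { (x ∷ []) → refl }) ,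
    λ x → (λ ()) , λ ()
  recursive-below (suc i) with recursive-below i | em {X i}
  ... | χ , cχ , χ-spec | no ¬Xi = χ , cχ , λ x →
    (λ (x<1+i , Xx) → proj₁ (χ-spec x) (below-i x<1+i Xx , Xx)) ,
    (λ χx≡0 → let (x<i , Xx) = proj₂ (χ-spec x) χx≡0 in m<n⇒m<1+n x<i , Xx)
    where
    below-i : ∀ {x} → x < suc i → X x → x < i
    below-i x<1+i Xx with m<1+n⇒m<n∨m≡n x<1+i
    ... | inj₁ x<i  = x<i
    ... | inj₂ refl = contradiction Xx ¬Xi
  ... | χ , cχ , χ-spec | yes Xi =
    (λ x → ∣ x - i ∣ * χ x) , computable , λ x → member x , nonmember x
    where
    computable : Computable (λ x → ∣ x - i ∣ * χ x)
    computable = computable₁⇒computable (computable-cong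
      (compose₂ computable-* (compose₂ computable-∣-∣ (lookupᶜ (# 0)) (constᶜ i))
                             (computable⇒computable₁ cχ))
      λ { (x ∷ []) → refl })
    member : ∀ x → x < suc i × X x → ∣ x - i ∣ * χ x ≡ 0
    member x (x<1+i , Xx) with m<1+n⇒m<n∨m≡n x<1+i
    ... | inj₁ x<i  = trans (cong (∣ x - i ∣ *_) (proj₁ (χ-spec x) (x<i , Xx))) (*-zeroʳ ∣ x - i ∣)
    ... | inj₂ refl = cong (_* χ x) (∣n-n∣≡0 x)
    nonmember : ∀ x → ∣ x - i ∣ * χ x ≡ 0 → x < suc i × X x
    nonmember x product≡0 with m*n≡0⇒m≡0∨n≡0 ∣ x - i ∣ product≡0
    ... | inj₁ ∣x-i∣≡0 with refl ← ∣m-n∣≡0⇒m≡n {x} {i} ∣x-i∣≡0 = ≤-refl , Xi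
    ... | inj₂ χx≡0 = let (x<i , Xx) = proj₂ (χ-spec x) χx≡0 in m<n⇒m<1+n x<i , Xx

  finite⇒recursive : Finite X → Recursive X
  finite⇒recursive (n , bounded) =
    recursive-cong (λ x → proj₂ , λ Xx → bounded x Xx , Xx) (recursive-below n)

module _ {X Y : Subset} where

  finite-⊆ : (∀ {x} → X x → Y x) → Finite Y → Finite X
  finite-⊆ X⊆Y (n , bounded) = n , λ x Xx → bounded x (X⊆Y Xx)

  finite-∪ : Finite X → Finite Y → Finite (λ x → X x ⊎ Y x)
  finite-∪ (m , X<m) (n , Y<n) = m ⊔ n , λ where
    x (inj₁ Xx) → m<n⇒m<n⊔o n (X<m x Xx)
    x (inj₂ Yx) → m<n⇒m<o⊔n m (Y<n x Yx)

finite-< : ∀ n → Finite (_< n)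
finite-< n = n , λ _ x<n → x<n

finite-subsingleton : ExcludedMiddle 0ℓ → ∀ {X} → (∀ {x y} → X x → X y → x ≡ y) → Finite X
finite-subsingleton em {X} unique with em {∃ X}
... | yes (x , Xx) = suc x , λ y Xy → s≤s (≤-reflexive (unique Xy Xx))
... | no  empty    = 0 , λ y Xy → ⊥-elim (empty (y , Xy))

module FiniteOneReduction
  (em : ExcludedMiddle 0ℓ) {A K T B : Subset}
  (complement-split : ∀ x → co A x ⇔' (K x ⊎ T x))
  (EA : Enumeration A) (EK : Enumeration K)
  {h : ℕ → ℕ} (computable-h : Computable₁ h) (h-reduction : IsMReduction A B h)
  {n₀ : ℕ} (D∩T-below : ∀ x → (D A h ∩ T) x → x < n₀)
  (inside : ComputablyUnbounded B) (outside : ComputablyUnbounded (co B))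
  where

  module EA = Enumeration EA
  module EK = Enumeration EK
  module In = ComputablyUnbounded inside
  module Out = ComputablyUnbounded outside

  firstOccurrence : ℕ → ℕ
  firstOccurrence x = leastZero (λ x′ → ∣ h x′ - h x ∣) x

  firstOccurrence-≤ : ∀ x → firstOccurrence x ≤ x
  firstOccurrence-≤ x = leastZero-≤ _ x

  h-firstOccurrence : ∀ x → h (firstOccurrence x) ≡ h x
  h-firstOccurrence x with m≤n⇒m<n∨m≡n (firstOccurrence-≤ x)
  ... | inj₁ earlier = ∣m-n∣≡0⇒m≡n (leastZero-found _ earlier)
  ... | inj₂ same    = cong h same

  not-before-firstOccurrence : ∀ {x y} → firstOccurrence y ≡ y → x < y → h x ≢ h y
  not-before-firstOccurrence {x} {y} first x<y hx≡hy = leastZero-minimal (λ x′ → ∣ h x′ - h y ∣) {y}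
    (subst (x <_) (sym first) x<y) (m≡n⇒∣m-n∣≡0 hx≡hy)

  firstOccurrence-unique : ∀ {x y} → firstOccurrence x ≡ x → firstOccurrence y ≡ y →
                           h x ≡ h y → x ≡ y
  firstOccurrence-unique first-x first-y hx≡hy = ≤-antisym
    (≮⇒≥ λ y<x → not-before-firstOccurrence first-x y<x (sym hx≡hy))
    (≮⇒≥ λ x<y → not-before-firstOccurrence first-y x<y hx≡hy)

  -- lateRepeat x ≢ 0 iff n₀ ≤ x and h x already occurred earlier.
  lateRepeat : ℕ → ℕ
  lateRepeat x = (suc x ∸ n₀) * (x ∸ firstOccurrence x)

  lateRepeat≡0 : ∀ {x} → lateRepeat x ≡ 0 → x < n₀ ⊎ firstOccurrence x ≡ x
  lateRepeat≡0 {x} lr≡0 with m*n≡0⇒m≡0∨n≡0 (suc x ∸ n₀) lr≡0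
  ... | inj₁ early = inj₁ (m∸n≡0⇒m≤n early)
  ... | inj₂ first = inj₂ (≤-antisym (firstOccurrence-≤ x) (m∸n≡0⇒m≤n first))

  lateRepeat≢0 : ∀ {x} → lateRepeat x ≢ 0 → n₀ ≤ x × firstOccurrence x < x
  lateRepeat≢0 {x} lr≢0 =
    ≮⇒≥ (λ x<n₀ → lr≢0 (cong (_* (x ∸ firstOccurrence x)) (m≤n⇒m∸n≡0 x<n₀))) ,
    ≤∧≢⇒< (firstOccurrence-≤ x) λ first → lr≢0 (begin
      (suc x ∸ n₀) * (x ∸ firstOccurrence x) ≡⟨ cong (λ y → (suc x ∸ n₀) * (x ∸ y)) first ⟩
      (suc x ∸ n₀) * (x ∸ x)                 ≡⟨ cong ((suc x ∸ n₀) *_) (n∸n≡0 x) ⟩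
      (suc x ∸ n₀) * 0                       ≡⟨ *-zeroʳ (suc x ∸ n₀) ⟩
      0                                      ∎)

  lateRepeat⇒A∪K : ∀ {x} → lateRepeat x ≢ 0 → A x ⊎ K x
  lateRepeat⇒A∪K {x} lr≢0 with em {A x}
  ... | yes Ax = inj₁ Ax
  ... | no ¬Ax with proj₁ (complement-split x) ¬Ax
  ...   | inj₁ Kx = inj₂ Kx
  ...   | inj₂ Tx =
    let (n₀≤x , earlier) = lateRepeat≢0 lr≢0
        x∈D = ¬Ax , firstOccurrence x , earlier , ¬A-first , h-firstOccurrence x
    in contradiction (D∩T-below x (x∈D , Tx)) (≤⇒≯ n₀≤x)
    where
    ¬A-first : ¬ A (firstOccurrence x)
    ¬A-first A-first =
      ¬Ax (proj₂ (h-reduction x) (subst B (h-firstOccurrence x) (proj₁ (h-reduction _) A-first)))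

  enumeratedA∪K : ℕ → ℕ → ℕ
  enumeratedA∪K s x = EA.enumerated s x + EK.enumerated s x

  pending : ℕ → ℕ → ℕ
  pending s x = if0 lateRepeat x then 0 else (if0 enumeratedA∪K s x then 1 else 0)

  pending-early : ∀ {s x} → lateRepeat x ≡ 0 → pending s x ≡ 0
  pending-early {s} {x} = cong (λ c → if0 c then 0 else (if0 enumeratedA∪K s x then 1 else 0))

  pending-enumerated : ∀ {s x} → lateRepeat x ≢ 0 → enumeratedA∪K s x ≢ 0 → pending s x ≡ 0
  pending-enumerated lr≢0 enumerated = trans (if0-≢0 0 _ lr≢0) (if0-≢0 1 0 enumerated)

  settles : ∀ x → ∃ λ s → pending s x ≡ 0
  settles x with lateRepeat x ≟ 0
  ... | yes lr≡0 = 0 , pending-early lr≡0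
  ... | no  lr≢0 with lateRepeat⇒A∪K lr≢0
  ...   | inj₁ Ax = let (s , enumerated) = EA.complete Ax in
    s , pending-enumerated lr≢0 λ sum≡0 → enumerated ≤-refl (m+n≡0⇒m≡0 _ sum≡0)
  ...   | inj₂ Kx = let (s , enumerated) = EK.complete Kx in
    s , pending-enumerated lr≢0 λ sum≡0 → enumerated ≤-refl (m+n≡0⇒n≡0 (EA.enumerated s x) sum≡0)

  settleStage : ℕ → ℕ
  settleStage x = leastZero (λ s → pending s x) (proj₁ (settles x))

  pending-settleStage : ∀ x → pending (settleStage x) x ≡ 0
  pending-settleStage x = leastZero-zero (λ s → pending s x) ≤-refl (proj₂ (settles x))

  settled-outside-A⇒K : ∀ {x} → lateRepeat x ≢ 0 → EA.enumerated (settleStage x) x ≡ 0 → K x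
  settled-outside-A⇒K {x} lr≢0 notA = EK.sound λ notK → contradiction (begin
    1                                                 ≡⟨ cong (λ c → if0 c then 1 else 0)
                                                               (sym (cong₂ _+_ notA notK)) ⟩
    if0 enumeratedA∪K (settleStage x) x then 1 else 0 ≡⟨ sym (if0-≢0 0 _ lr≢0) ⟩
    pending (settleStage x) x                         ≡⟨ pending-settleStage x ⟩
    0                                                 ∎) λ ()

  lateImage : ℕ → ℕ
  lateImage x = if0 EA.enumerated (settleStage x) x then Out.select x else In.select x

  g : ℕ → ℕ
  g x = if0 lateRepeat x then h x else lateImage x

  g-early : ∀ {x} → lateRepeat x ≡ 0 → g x ≡ h x
  g-early {x} = cong (λ c → if0 c then h x else lateImage x)

  g-late : ∀ {x} → lateRepeat x ≢ 0 → g x ≡ lateImage x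
  g-late = if0-≢0 _ _

  lateImage-above : ∀ x → x ≤ lateImage x
  lateImage-above x = if0-elim {x ≤_} (EA.enumerated (settleStage x) x) (Out.above x) (In.above x)

  g-reduction : IsMReduction A B g
  g-reduction x = by-cases (lateRepeat x ≟ 0) (EA.enumerated (settleStage x) x ≟ 0)
    where
    reduces-via : ∀ {y} → g x ≡ y → A x ⇔' B y → A x ⇔' B (g x)
    reduces-via gx≡y = subst (λ y → A x ⇔' B y) (sym gx≡y)
    by-cases : Dec (lateRepeat x ≡ 0) → Dec (EA.enumerated (settleStage x) x ≡ 0) → A x ⇔' B (g x)
    by-cases (yes lr≡0) _ = reduces-via (g-early lr≡0) (h-reduction x)
    by-cases (no lr≢0) (no inA) = reduces-via (trans (g-late lr≢0) (if0-≢0 _ _ inA))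
      ((λ _ → In.member x) , λ _ → EA.sound inA)
    by-cases (no lr≢0) (yes notA) =
      reduces-via (trans (g-late lr≢0) (cong (λ c → if0 c then Out.select x else In.select x) notA))
        ((λ Ax → ⊥-elim (proj₂ (complement-split x) (inj₁ (settled-outside-A⇒K lr≢0 notA)) Ax)) ,
         λ B-out → ⊥-elim (Out.member x B-out))

  g-fibre : ∀ {y x} → g x ≡ y → x < n₀ ⊎ (firstOccurrence x ≡ x × h x ≡ y) ⊎ x < suc y
  g-fibre {y} {x} gx≡y = by-cases (lateRepeat x ≟ 0)
    where
    by-cases : Dec (lateRepeat x ≡ 0) → x < n₀ ⊎ (firstOccurrence x ≡ x × h x ≡ y) ⊎ x < suc y
    by-cases (no lr≢0)  =
      inj₂ (inj₂ (s≤s (subst (x ≤_) (trans (sym (g-late lr≢0)) gx≡y) (lateImage-above x))))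
    by-cases (yes lr≡0) with lateRepeat≡0 lr≡0
    ... | inj₁ x<n₀  = inj₁ x<n₀
    ... | inj₂ first = inj₂ (inj₁ (first , trans (sym (g-early lr≡0)) gx≡y))

  g-finiteOne : FiniteOne g
  g-finiteOne y = finite-⊆ g-fibre
    (finite-∪ (finite-< n₀)
    (finite-∪ (finite-subsingleton em λ (first-x , hx≡y) (first-x′ , hx′≡y) →
                 firstOccurrence-unique first-x first-x′ (trans hx≡y (sym hx′≡y)))
              (finite-< (suc y))))

  computable-firstOccurrence : Computable₁ firstOccurrence
  computable-firstOccurrence = computable-cong
    (computable-leastZero (compose₂ computable-∣-∣ (compose₁ computable-h (lookupᶜ (# 0)))
                                                   (compose₁ computable-h (lookupᶜ (# 1)))))
    λ { (x ∷ []) → refl }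

  computable-lateRepeat : Computable₁ lateRepeat
  computable-lateRepeat = computable-cong
    (compose₂ computable-*
      (compose₂ computable-∸ (compose₁ computable-suc (lookupᶜ (# 0))) (constᶜ n₀))
      (compose₂ computable-∸ (lookupᶜ (# 0)) (compose₁ computable-firstOccurrence (lookupᶜ (# 0)))))
    λ { (x ∷ []) → refl }

  computable-pending : Computable₂ pending
  computable-pending = computable-cong
    (compose₃ computable-if0 (compose₁ computable-lateRepeat (lookupᶜ (# 1))) (constᶜ 0)
      (compose₃ computable-if0
        (compose₂ computable-+ (compose₂ EA.computable (lookupᶜ (# 0)) (lookupᶜ (# 1)))
                               (compose₂ EK.computable (lookupᶜ (# 0)) (lookupᶜ (# 1))))
        (constᶜ 1) (constᶜ 0)))
    λ { (s ∷ x ∷ []) → refl }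

  computable-settleStage : Computable₁ settleStage
  computable-settleStage = computable-cong
    (computable-μ computable-pending (λ { (x ∷ []) → proj₁ (settles x) })
                                     (λ { (x ∷ []) → proj₂ (settles x) }))
    λ { (x ∷ []) → refl }

  computable-g : Computable₁ g
  computable-g = computable-cong
    (compose₃ computable-if0 (compose₁ computable-lateRepeat x₀) (compose₁ computable-h x₀)
      (compose₃ computable-if0 (compose₂ EA.computable (compose₁ computable-settleStage x₀) x₀)
                               (compose₁ Out.computable x₀) (compose₁ In.computable x₀)))
    λ { (x ∷ []) → refl }
    where
    x₀ : Computableⁿ 1 (λ xs → lookup xs (# 0))
    x₀ = lookupᶜ (# 0)

  g-≤fo : A ≤fo B
  g-≤fo = g , computable₁⇒computable computable-g , g-reduction , g-finiteOne

corollary2p9 : ExcludedMiddle 0ℓ →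
    (A K T : Subset) →
    CE A → ¬ Recursive A →
    (∀ x → co A x ⇔' (K x ⊎ T x)) →
    (∀ x → ¬ (K x × T x)) →
    CE K →
    (∀ B → B ≡m A →
      (∀ h → Computable h → IsMReduction A B h → Finite (D A h ∩ T))
      × (∀ f → Computable f → IsMReduction B A f → Infinite (λ x → K (f x)))) →
    ∀ B → B ≡m A → A ≤fo B
corollary2p9 em A K T ce-A nonrecursive-A complement-split _ ce-K hypotheses
             B B≡mA@((f , cf , f-reduction) , (h , ch , h-reduction)) =
  FiniteOneReduction.g-≤fo em {B = B} complement-split EA EK (computable⇒computable₁ ch) h-reduction
    (proj₂ (D∩T-finite h ch h-reduction)) inside outside
  where
  D∩T-finite : ∀ h → Computable h → IsMReduction A B h → Finite (D A h ∩ T)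
  D∩T-finite = proj₁ (hypotheses B B≡mA)
  f⁻¹K-infinite : ∀ f → Computable f → IsMReduction B A f → Infinite (λ x → K (f x))
  f⁻¹K-infinite = proj₂ (hypotheses B B≡mA)
  EA : Enumeration A
  EA = ce⇒enumeration ce-A
  EK : Enumeration K
  EK = ce⇒enumeration ce-K
  B-infinite : Infinite B
  B-infinite = nonrecursive-A ∘ ≤m⇒recursive (h , ch , h-reduction) ∘ finite⇒recursive em
  inside : ComputablyUnbounded B
  inside = computablyUnbounded-mono (λ {y} → proj₂ (f-reduction y))
    (enumeration⇒computablyUnbounded (enumeration-∘ EA (computable⇒computable₁ cf))
      (infinite⇒unbounded em (B-infinite ∘ finite-⊆ (λ {y} → proj₁ (f-reduction y)))))
  outside : ComputablyUnbounded (co B)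
  outside = computablyUnbounded-mono
    (λ {y} Kfy By → proj₂ (complement-split (f y)) (inj₁ Kfy) (proj₁ (f-reduction y) By))
    (enumeration⇒computablyUnbounded (enumeration-∘ EK (computable⇒computable₁ cf))
      (infinite⇒unbounded em (f⁻¹K-infinite f cf f-reduction)))
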